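{- For every integer $n \geq 1$, the bijection $\alpha_n$ satisfies $\alpha_n(\pi_n) = \pi_n$, and its inverse satisfies $\alpha_n^{ -1}(\pi_n) = \pi_n$.
   Context: For $n \geq 0$ let $\mathfrak{S}_n$ be the set of permutations of $[n]=\{1,\dots,n\}$ ($\mathfrak{S}_0$ consists of the empty permutation $()$), written in disjoint cycle notation. Let $D_n\subseteq \mathfrak{S}_n$ be the set of derangements (permutations with no fixed point) and $E_n \subseteq \mathfrak{S}_n$ the set of permutations with exactly one fixed point. Define $\pi_n = (1\,2)(3\,4)\cdots(n-1\;n)$ if $n$ is even and $\pi_n=(1\,2)(3\,4)\cdots(n-2\;\,n-1)(n)$ if $n$ is odd; so $\pi_0=()$, $\pi_1=(1)$, $\pi_n\in D_n$ for $n$ even and $\pi_n \in E_n$ for $n$ odd. Let $\Pi_n=\{\pi_n\}$. For $\sigma\in\mathfrak{S}_n$ and $a\in[n]$, $\sigma\setminus a$ denotes the permutation of $[n]\setminus\{a\}$ obtained by deleting $a$ from the disjoint cycle decomposition of $\sigma$: $(\sigma\setminus a)(x)=\sigma(x)$ if $\sigma(x)\neq a$, and $(\sigma\setminus a)(\sigma^{ -1}(a))=\sigma(a)$ if $\sigma(a)\ne a$. In particular $\sigma\setminus n\in\mathfrak{S}_{n-1}$. For $n\ge 1$ define the bijection $f_n:[n]\times D_{n-1}\to E_n$ by: for $m<n$, $f_n(m,\sigma)$ is the permutation $\tau$ of $[n]$ obtained by replacing $m$ by $n$ in the cycle decomposition of $\sigma$ and adding the fixed point $m$ (i.e. $\tau(m)=m$,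 $\tau(\sigma^{ -1}(m))=n$, $\tau(n)=\sigma(m)$, $\tau(x)=\sigma(x)$ otherwise); and $f_n(n,\sigma)$ is $\sigma$ with the fixed point $n$ appended. Define bijections $\alpha_n$ recursively: for $n$ even, $\alpha_n: D_n\to E_n\sqcup \Pi_n$; for $n$ odd, $\alpha_n: D_n\sqcup\Pi_n\to E_n$ (these unions are disjoint). Let $\alpha_0$ send $()$ to $\pi_0$ and $\alpha_1$ send $\pi_1$ to $(1)$. For $n\ge 2$ and $\sigma$ in the domain of $\alpha_n$, with $\alpha_{n-1}^{ -1}$ the inverse of the bijection $\alpha_{n-1}$: (i) if $\sigma\in D_n$ and $n$ lies in a cycle of $\sigma$ of length at least $3$, then $\alpha_n(\sigma)=f_n(\sigma(n),\sigma\setminus n)$; (ii) if $\sigma\in D_n$ and $n$ lies in a $2$-cycle of $\sigma$, then $\sigma\setminus n\in E_{n-1}$; let $\rho=\alpha_{n-1}^{ -1}(\sigma\setminus n)$. If $\rho\in D_{n-1}$, then $\alpha_n(\sigma)=f_n(n,\rho)$; if $\rho=\pi_{n-1}\in\Pi_{n-1}$ (possible only for $n$ even), then $\alpha_n(\sigma)=\pi_n\in\Pi_n$; (iii) if $n$ is odd and $\sigma=\pi_n\in\Pi_n$, then $\alpha_n(\pi_n)=f_n\big(n,\alpha_{n-1}^{ -1}(\pi_{n-1})\big)$, where $\pi_{n-1}$ is regarded as the element of $\Pi_{n-1}$ in the domain of $\alpha_{n-1}^{ -1}$. -}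

module Defs where

open import Data.Nat as ℕ using (ℕ; zero; suc)
open import Data.Fin as Fin using (Fin; zero; suc; toℕ; fromℕ; inject₁; lower₁)
open import Data.Vec as Vec using (Vec; []; _∷_; lookup; tabulate)
open import Data.Vec.Properties using (≡-dec)
open import Data.List as List using (List)
open import Data.Maybe using (Maybe; just; nothing; maybe; fromMaybe)
open import Data.Bool using (Bool; true; false; if_then_else_; _∧_; _∨_; not)
open import Function using (id)
open import Relation.Nullary.Decidable using (⌊_⌋; yes; no)

-- Conventions.
-- [n] = {1,…,n} is encoded as Fin n, the paper's element k being the
-- Fin-index k-1; in particular the paper's element n of [n] = Fin (suc m)
-- is  fromℕ m  (the last element).
-- A permutation σ of [n] is stored in one-line notation as a vector
-- Perm n = Vec (Fin n) n with σ(i) = lookup σ i.  Genuine permutations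
-- are the injective such vectors (see isPerm).  The maps below are total
-- functions on all of Perm n; only their values on the paper's domains
-- matter.

Perm : ℕ → Set
Perm n = Vec (Fin n) n

infix 4 _=ᶠ_ _=ᵛ_
_=ᶠ_ : ∀ {n} → Fin n → Fin n → Bool
i =ᶠ j = ⌊ i Fin.≟ j ⌋

_=ᵛ_ : ∀ {n} → Perm n → Perm n → Bool
σ =ᵛ τ = ⌊ ≡-dec Fin._≟_ σ τ ⌋

isOdd : ℕ → Bool
isOdd zero = false
isOdd (suc zero) = true
isOdd (suc (suc n)) = isOdd n

allᵇ : ∀ {a} {A : Set a} → (A → Bool) → List A → Bool
allᵇ p List.[] = true
allᵇ p (x List.∷ xs) = p x ∧ allᵇ p xs

isPerm : ∀ {n} → Perm n → Bool
isPerm {n} σ = allᵇ (λ i → allᵇ (λ j → (i =ᶠ j) ∨ not (lookup σ i =ᶠ lookup σ j))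
                                          (List.allFin n)) (List.allFin n)

isDerangement : ∀ {n} → Perm n → Bool
isDerangement {n} σ = isPerm σ ∧ allᵇ (λ i → not (lookup σ i =ᶠ i)) (List.allFin n)

-- π_n = (1 2)(3 4)… (with the fixed point n when n is odd)
pi : (n : ℕ) → Perm n
pi zero = []
pi (suc zero) = zero ∷ []
pi (suc (suc k)) = suc zero ∷ zero ∷ Vec.map (λ i → suc (suc i)) (pi k)

-- the domain of α_n : D_n for n even, D_n ⊔ Π_n for n odd
-- (the union is disjoint inside 𝔖_n, so it is realised as a subset of Perm n)
inDomain : (n : ℕ) → Perm n → Bool
inDomain n σ = isDerangement σ ∨ (isOdd n ∧ (σ =ᵛ pi n))

-- view of an element of Fin (suc m): nothing = the last element (paper's
-- element m+1), just x = the element inject₁ x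
lastOr : ∀ {m} → Fin (suc m) → Maybe (Fin m)
lastOr {m} y with m ℕ.≟ toℕ y
... | yes _ = nothing
... | no ne = just (lower₁ y ne)

-- σ \ n for σ ∈ 𝔖_n  (n = suc m the last element)
del : ∀ {m} → Perm (suc m) → Perm m
del {m} σ = tabulate λ x →
  maybe id (maybe id x (lastOr (lookup σ (fromℕ m)))) (lastOr (lookup σ (inject₁ x)))

-- f_n (k , σ) with n = suc m, k ∈ [n], σ ∈ 𝔖_{n-1}
f : ∀ {m} → Fin (suc m) → Perm m → Perm (suc m)
f {m} k σ = maybe fSmall fLast (lastOr k)
  where
  -- k = n : append the fixed point n
  fLast : Perm (suc m)
  fLast = tabulate λ y → maybe (λ x → inject₁ (lookup σ x)) (fromℕ m) (lastOr y)
  -- k = j < n : replace j by n in the cycles of σ and add the fixed point j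
  fSmall : Fin m → Perm (suc m)
  fSmall j = tabulate λ y → maybe
    (λ x → if x =ᶠ j then inject₁ j
           else (if lookup σ x =ᶠ j then fromℕ m else inject₁ (lookup σ x)))
    (inject₁ (lookup σ j))
    (lastOr y)

allVecs : (n k : ℕ) → List (Vec (Fin n) k)
allVecs n zero = [] List.∷ List.[]
allVecs n (suc k) = List.concatMap (λ v → List.map (λ i → i ∷ v) (List.allFin n)) (allVecs n k)

find : ∀ {a} {A : Set a} → (A → Bool) → List A → Maybe A
find p List.[] = nothing
find p (x List.∷ xs) = if p x then just x else find p xs

-- Inverse of a map g on the domain of α_n: invOn n g τ is the first
-- element σ of the domain of α_n with g σ = τ, found by exhaustive search
-- (default τ if none exists).
invOn : (n : ℕ) → (Perm n → Perm n) → Perm n → Perm n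
invOn n g τ = fromMaybe τ (find (λ σ → inDomain n σ ∧ (g σ =ᵛ τ)) (allVecs n n))

-- One step of the recursion: given α_{n-1} (n = suc (suc m)), compute α_n σ.
-- α_{n-1}⁻¹ is the inverse of α_{n-1} on its domain (unique since α_{n-1}
-- is a bijection), realised by invOn.
αStep : (m : ℕ) → (Perm (suc m) → Perm (suc m)) → Perm (suc (suc m)) → Perm (suc (suc m))
αStep m αprev σ =
  if isOdd (suc (suc m)) ∧ (σ =ᵛ pi (suc (suc m)))
  then f nn (prevInv (pi (suc m)))                               -- (iii)
  else (if lookup σ (lookup σ nn) =ᶠ nn
        then (if isOdd (suc m) ∧ (ρ =ᵛ pi (suc m))                -- (ii)
              then pi (suc (suc m))
              else f nn ρ)
        else f (lookup σ nn) (del σ))                            -- (i)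
  where
  nn : Fin (suc (suc m))
  nn = fromℕ (suc m)
  prevInv : Perm (suc m) → Perm (suc m)
  prevInv = invOn (suc m) αprev
  ρ : Perm (suc m)
  ρ = prevInv (del σ)

α : (n : ℕ) → Perm n → Perm n
α zero σ = pi zero
α (suc zero) σ = zero ∷ []
α (suc (suc m)) = αStep m (α (suc m))

αInv : (n : ℕ) → Perm n → Perm n
αInv n = invOn n (α n)

-- Induction on n, carrying along that π_n is the only element of the domain of α_n sent to
-- π_n; since α_n⁻¹ is computed by search, this is what makes α_n⁻¹(π_n) = π_n.
-- Write N for the new point.  If N is odd, rule (iii) appends the fixed point N to
-- α_{N-1}⁻¹(π_{N-1}) = π_{N-1}, giving π_N.  If N is even, π_N swaps N-1 and N and
-- π_N ∖ N = π_{N-1}, so rule (ii) returns π_N.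
-- Conversely let σ be a derangement with α_N(σ) = π_N.  Rule (i) would create the fixed
-- point σ(N) ≠ N, but π_N fixes at most N; so σ swaps N with some j, and σ ∖ N fixes j.
-- If rule (ii) returns f_N(N, ρ), then N is fixed, so N is odd and ρ = π_{N-1}; hence
-- σ ∖ N = π_{N-1}, which has no fixed point.  Otherwise σ ∖ N = π_{N-1} with N even, and
-- the 2-cycle (j N) of σ forces j = N-1 and σ = π_N.
module Submission where

open import Defs
open import Data.Nat using (ℕ; zero; suc; _≤_)
open import Data.Nat.Properties using (<-irrefl)
open import Data.Bool using (Bool; true; false; not; _∧_; if_then_else_)
open import Data.Bool.Properties using (T-≡; if-cong; ∧-zeroʳ; ∨-identityʳ)
open import Data.Fin as Fin using (Fin; zero; suc; toℕ; fromℕ; inject₁)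
open import Data.Fin.Properties
  using (toℕ<n; toℕ-fromℕ; toℕ-inject₁; lower₁-inject₁′; inject₁-injective; fromℕ≢inject₁; suc-injective)
open import Data.Vec using ([]; _∷_; lookup)
open import Data.Vec.Properties using (lookup∘tabulate; lookup-map; ≡-dec)
open import Data.Vec.Relation.Binary.Pointwise.Extensional using (ext; Pointwise-≡⇒≡)
open import Data.List as List using ()
open import Data.List.Membership.Propositional using (_∈_)
open import Data.List.Membership.Propositional.Properties using (∈-allFin)
open import Data.List.Relation.Unary.Any using (here; there)
open import Data.Maybe using (just; nothing; maybe)
open import Data.Product using (Σ; _×_; _,_; proj₁; proj₂)
open import Data.Sum using (_⊎_; inj₁; inj₂)
open import Data.Empty using (⊥-elim)
open import Function using (_∘_)
open import Function.Bundles using (Equivalence)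
open import Relation.Nullary using (¬_; Dec; yes; no; contradiction)
open import Relation.Nullary.Decidable
  using (isYes; isYes≗does; dec-true; dec-false; toWitness; decidable-stable)
open import Relation.Binary.Definitions using (DecidableEquality)
open import Relation.Binary.PropositionalEquality
open ≡-Reasoning

isYes-yes : ∀ {a} {A : Set a} (a? : Dec A) → A → isYes a? ≡ true
isYes-yes a? a = trans (isYes≗does a?) (dec-true a? a)

isYes-no : ∀ {a} {A : Set a} (a? : Dec A) → ¬ A → isYes a? ≡ false
isYes-no a? ¬a = trans (isYes≗does a?) (dec-false a? ¬a)

_≟ᵖ_ : ∀ {n} → DecidableEquality (Perm n)
_≟ᵖ_ = ≡-dec Fin._≟_

=ᵛ⇒≡ : ∀ {n} {σ τ : Perm n} → (σ =ᵛ τ) ≡ true → σ ≡ τ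
=ᵛ⇒≡ {σ = σ} {τ} σ=τ = toWitness {a? = σ ≟ᵖ τ} (Equivalence.from T-≡ σ=τ)

parity : ∀ n → isOdd n ≡ true ⊎ isOdd n ≡ false
parity n with isOdd n
... | true = inj₁ refl
... | false = inj₂ refl

isOdd-suc : ∀ n → isOdd (suc n) ≡ not (isOdd n)
isOdd-suc zero = refl
isOdd-suc (suc zero) = refl
isOdd-suc (suc (suc n)) = isOdd-suc n

odd⇒suc-even : ∀ n → isOdd n ≡ true → isOdd (suc n) ≡ false
odd⇒suc-even n odd = trans (isOdd-suc n) (cong not odd)

even⇒suc-odd : ∀ n → isOdd n ≡ false → isOdd (suc n) ≡ true
even⇒suc-odd n even = trans (isOdd-suc n) (cong not even)

allᵇ-∈ : ∀ {a} {A : Set a} {p : A → Bool} {xs x} → allᵇ p xs ≡ true → x ∈ xs → p x ≡ true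
allᵇ-∈ {p = p} {y List.∷ _} all (here refl) with p y | all
... | true | _ = refl
allᵇ-∈ {p = p} {y List.∷ _} all (there x∈ys) with p y | all
... | true | all′ = allᵇ-∈ all′ x∈ys

isDerangement⇒noFix : ∀ {n} (σ : Perm n) → isDerangement σ ≡ true → ∀ i → lookup σ i ≢ i
isDerangement⇒noFix σ der i σi≡i with isPerm σ | der
... | true | noFix = contradiction (trans (sym (cong not fixed)) (allᵇ-∈ noFix (∈-allFin i))) λ ()
  where
  fixed : (lookup σ i =ᶠ i) ≡ true
  fixed = isYes-yes (lookup σ i Fin.≟ i) σi≡i

inDomain⇒isDerangement : ∀ {n} {σ : Perm n} → σ ≢ pi n → inDomain n σ ≡ true → isDerangement σ ≡ true
inDomain⇒isDerangement {n} {σ} σ≢π dom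
  rewrite isYes-no (σ ≟ᵖ pi n) σ≢π | ∧-zeroʳ (isOdd n) | ∨-identityʳ (isDerangement σ) = dom

-- Deleting the last point and appending a fixed point

data LastOrInject {k : ℕ} : Fin (suc k) → Set where
  last : LastOrInject (fromℕ k)
  inj  : (x : Fin k) → LastOrInject (inject₁ x)

lastOrInject : ∀ {k} (y : Fin (suc k)) → LastOrInject y
lastOrInject {zero} zero = last
lastOrInject {suc k} zero = inj zero
lastOrInject {suc k} (suc y) with lastOrInject y
... | last = last
... | inj x = inj (suc x)

≢fromℕ⇒inject₁ : ∀ {k} (y : Fin (suc k)) → y ≢ fromℕ k → Σ (Fin k) λ j → y ≡ inject₁ j
≢fromℕ⇒inject₁ y y≢n with lastOrInject y
... | last = contradiction refl y≢n
... | inj j = j , refl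

lastOr-fromℕ : ∀ k → lastOr (fromℕ k) ≡ nothing
lastOr-fromℕ k with k Data.Nat.≟ toℕ (fromℕ k)
... | yes _ = refl
... | no k≢k = contradiction (sym (toℕ-fromℕ k)) k≢k

lastOr-inject₁ : ∀ {k} (x : Fin k) → lastOr (inject₁ x) ≡ just x
lastOr-inject₁ {k} x with k Data.Nat.≟ toℕ (inject₁ x)
... | yes k≡x = contradiction (toℕ<n x) (<-irrefl (sym (trans k≡x (toℕ-inject₁ x))))
... | no k≢x = cong just (lower₁-inject₁′ x k≢x)

lookup-del : ∀ {m} (σ : Perm (suc m)) x {y} → lookup σ (inject₁ x) ≡ inject₁ y → lookup (del σ) x ≡ y
lookup-del {m} σ x {y} σx≡y
  rewrite lookup∘tabulate (λ x → maybe (λ z → z) (maybe (λ z → z) x (lastOr (lookup σ (fromℕ m))))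
                                                (lastOr (lookup σ (inject₁ x)))) x
        | σx≡y | lastOr-inject₁ y = refl

lookup-del-skip : ∀ {m} (σ : Perm (suc m)) x {y} →
  lookup σ (inject₁ x) ≡ fromℕ m → lookup σ (fromℕ m) ≡ inject₁ y → lookup (del σ) x ≡ y
lookup-del-skip {m} σ x {y} σx≡n σn≡y
  rewrite lookup∘tabulate (λ x → maybe (λ z → z) (maybe (λ z → z) x (lastOr (lookup σ (fromℕ m))))
                                                (lastOr (lookup σ (inject₁ x)))) x
        | σx≡n | σn≡y | lastOr-fromℕ m | lastOr-inject₁ y = refl

lookup-f-fromℕ : ∀ {m} (ρ : Perm m) y →
  lookup (f (fromℕ m) ρ) y ≡ maybe (λ x → inject₁ (lookup ρ x)) (fromℕ m) (lastOr y)
lookup-f-fromℕ {m} ρ y rewrite lastOr-fromℕ m =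
  lookup∘tabulate (λ y → maybe (λ x → inject₁ (lookup ρ x)) (fromℕ m) (lastOr y)) y

lookup-f-fromℕ-inject₁ : ∀ {m} (ρ : Perm m) x → lookup (f (fromℕ m) ρ) (inject₁ x) ≡ inject₁ (lookup ρ x)
lookup-f-fromℕ-inject₁ ρ x = trans (lookup-f-fromℕ ρ (inject₁ x)) (cong (maybe _ _) (lastOr-inject₁ x))

lookup-f-fromℕ-fromℕ : ∀ {m} (ρ : Perm m) → lookup (f (fromℕ m) ρ) (fromℕ m) ≡ fromℕ m
lookup-f-fromℕ-fromℕ {m} ρ = trans (lookup-f-fromℕ ρ (fromℕ m)) (cong (maybe _ _) (lastOr-fromℕ m))

lookup-f-fixed : ∀ {m} (k : Fin (suc m)) (ρ : Perm m) → lookup (f k ρ) k ≡ k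
lookup-f-fixed k ρ with lastOrInject k
... | last = lookup-f-fromℕ-fromℕ ρ
lookup-f-fixed {m} _ ρ | inj j
  rewrite lastOr-inject₁ j
        | lookup∘tabulate (λ y → maybe (λ x → if x =ᶠ j then inject₁ j
                                              else (if lookup ρ x =ᶠ j then fromℕ m else inject₁ (lookup ρ x)))
                                       (inject₁ (lookup ρ j)) (lastOr y)) (inject₁ j)
        | lastOr-inject₁ j | isYes-yes (j Fin.≟ j) refl = refl

f-fromℕ-injective : ∀ {m} {ρ τ : Perm m} → f (fromℕ m) ρ ≡ f (fromℕ m) τ → ρ ≡ τ
f-fromℕ-injective {ρ = ρ} {τ} fρ≡fτ = Pointwise-≡⇒≡ (ext λ x → inject₁-injective (begin
  inject₁ (lookup ρ x)          ≡⟨ lookup-f-fromℕ-inject₁ ρ x ⟨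
  lookup (f _ ρ) (inject₁ x)    ≡⟨ cong (λ v → lookup v (inject₁ x)) fρ≡fτ ⟩
  lookup (f _ τ) (inject₁ x)    ≡⟨ lookup-f-fromℕ-inject₁ τ x ⟩
  inject₁ (lookup τ x)          ∎))

-- The permutation π_n

lookup-pi-suc-suc : ∀ n (i : Fin n) → lookup (pi (suc (suc n))) (suc (suc i)) ≡ suc (suc (lookup (pi n) i))
lookup-pi-suc-suc n i = lookup-map i (λ i → suc (suc i)) (pi n)

pi-involutive : ∀ n (i : Fin n) → lookup (pi n) (lookup (pi n) i) ≡ i
pi-involutive (suc zero) zero = refl
pi-involutive (suc (suc n)) zero = refl
pi-involutive (suc (suc n)) (suc zero) = refl
pi-involutive (suc (suc n)) (suc (suc i))
  rewrite lookup-pi-suc-suc n i | lookup-pi-suc-suc n (lookup (pi n) i) | pi-involutive n i = refl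

pi-fixed⇒fromℕ : ∀ n (i : Fin (suc n)) → lookup (pi (suc n)) i ≡ i → i ≡ fromℕ n
pi-fixed⇒fromℕ zero zero _ = refl
pi-fixed⇒fromℕ (suc (suc n)) (suc (suc i)) πi≡i = cong (λ i → suc (suc i))
  (pi-fixed⇒fromℕ n i (suc-injective (suc-injective (trans (sym (lookup-pi-suc-suc (suc n) i)) πi≡i))))

pi-noFix : ∀ n → isOdd n ≡ false → (i : Fin n) → lookup (pi n) i ≢ i
pi-noFix (suc (suc n)) even (suc (suc i)) πi≡i =
  pi-noFix n even i (suc-injective (suc-injective (trans (sym (lookup-pi-suc-suc n i)) πi≡i)))

pi-fromℕ : ∀ n → isOdd n ≡ false → lookup (pi (suc n)) (fromℕ n) ≡ fromℕ n
pi-fromℕ zero _ = refl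
pi-fromℕ (suc (suc n)) even =
  trans (lookup-pi-suc-suc (suc n) (fromℕ n)) (cong (λ i → suc (suc i)) (pi-fromℕ n even))

pi-fromℕ-suc : ∀ n → isOdd n ≡ false → lookup (pi (suc (suc n))) (fromℕ (suc n)) ≡ inject₁ (fromℕ n)
pi-fromℕ-suc zero _ = refl
pi-fromℕ-suc (suc (suc n)) even =
  trans (lookup-pi-suc-suc (suc (suc n)) (fromℕ (suc n))) (cong (λ i → suc (suc i)) (pi-fromℕ-suc n even))

pi-inject₁-fromℕ : ∀ n → isOdd n ≡ false → lookup (pi (suc (suc n))) (inject₁ (fromℕ n)) ≡ fromℕ (suc n)
pi-inject₁-fromℕ n even = trans (cong (lookup (pi (suc (suc n)))) (sym (pi-fromℕ-suc n even)))
                                (pi-involutive (suc (suc n)) (fromℕ (suc n)))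

pi-inject₁ : ∀ n → isOdd n ≡ false → (i : Fin n) → lookup (pi (suc n)) (inject₁ i) ≡ inject₁ (lookup (pi n) i)
pi-inject₁ (suc (suc n)) even zero = refl
pi-inject₁ (suc (suc n)) even (suc zero) = refl
pi-inject₁ (suc (suc n)) even (suc (suc i)) rewrite lookup-pi-suc-suc n i =
  trans (lookup-pi-suc-suc (suc n) (inject₁ i)) (cong (λ i → suc (suc i)) (pi-inject₁ n even i))

pi-inject₁-inject₁ : ∀ n → isOdd n ≡ false → (i : Fin n) →
  lookup (pi (suc (suc n))) (inject₁ (inject₁ i)) ≡ inject₁ (lookup (pi (suc n)) (inject₁ i))
pi-inject₁-inject₁ (suc (suc n)) even zero = refl
pi-inject₁-inject₁ (suc (suc n)) even (suc zero) = refl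
pi-inject₁-inject₁ (suc (suc n)) even (suc (suc i)) rewrite lookup-pi-suc-suc (suc n) (inject₁ i) =
  trans (lookup-pi-suc-suc (suc (suc n)) (inject₁ (inject₁ i)))
        (cong (λ i → suc (suc i)) (pi-inject₁-inject₁ n even i))

pi-inject₁≢fromℕ : ∀ n → isOdd n ≡ false → (i : Fin n) → lookup (pi (suc n)) (inject₁ i) ≢ fromℕ n
pi-inject₁≢fromℕ n even i πi≡n = fromℕ≢inject₁ (begin
  fromℕ n                                                ≡⟨ pi-fromℕ n even ⟨
  lookup (pi (suc n)) (fromℕ n)                          ≡⟨ cong (lookup (pi (suc n))) πi≡n ⟨
  lookup (pi (suc n)) (lookup (pi (suc n)) (inject₁ i))  ≡⟨ pi-involutive (suc n) (inject₁ i) ⟩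
  inject₁ i                                              ∎)

f-fromℕ-pi : ∀ n → isOdd n ≡ false → f (fromℕ n) (pi n) ≡ pi (suc n)
f-fromℕ-pi n even = Pointwise-≡⇒≡ (ext λ i → go i (lastOrInject i))
  where
  go : ∀ i → LastOrInject i → lookup (f (fromℕ n) (pi n)) i ≡ lookup (pi (suc n)) i
  go _ last = trans (lookup-f-fromℕ-fromℕ (pi n)) (sym (pi-fromℕ n even))
  go _ (inj x) = trans (lookup-f-fromℕ-inject₁ (pi n) x) (sym (pi-inject₁ n even x))

del-pi : ∀ n → isOdd n ≡ false → del (pi (suc (suc n))) ≡ pi (suc n)
del-pi n even = Pointwise-≡⇒≡ (ext λ x → go x (lastOrInject x))
  where
  π : Perm (suc (suc n))
  π = pi (suc (suc n))
  go : ∀ x → LastOrInject x → lookup (del π) x ≡ lookup (pi (suc n)) x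
  go _ last = trans (lookup-del-skip π (fromℕ n) (pi-inject₁-fromℕ n even) (pi-fromℕ-suc n even))
                    (sym (pi-fromℕ n even))
  go _ (inj y) = lookup-del π (inject₁ y) (pi-inject₁-inject₁ n even y)

del≡pi⇒≡pi : ∀ m (σ : Perm (suc (suc m))) {j} → isOdd m ≡ false →
  lookup σ (fromℕ (suc m)) ≡ inject₁ j → lookup σ (inject₁ j) ≡ fromℕ (suc m) →
  del σ ≡ pi (suc m) → σ ≡ pi (suc (suc m))
del≡pi⇒≡pi m σ {j} even σn≡j σj≡n del≡π = Pointwise-≡⇒≡ (ext λ i → go i (lastOrInject i))
  where
  π : Perm (suc (suc m))
  π = pi (suc (suc m))
  delσ≡π : ∀ x → lookup (del σ) x ≡ lookup (pi (suc m)) x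
  delσ≡π x = cong (λ τ → lookup τ x) del≡π
  j≡m : j ≡ fromℕ m
  j≡m = pi-fixed⇒fromℕ m j (trans (sym (delσ≡π j)) (lookup-del-skip σ j σj≡n σn≡j))
  goInner : ∀ y v → lookup σ (inject₁ (inject₁ y)) ≡ v → LastOrInject v →
            lookup σ (inject₁ (inject₁ y)) ≡ lookup π (inject₁ (inject₁ y))
  goInner y _ σy≡n last = contradiction
    (trans (sym (delσ≡π (inject₁ y))) (trans (lookup-del-skip σ (inject₁ y) σy≡n σn≡j) j≡m))
    (pi-inject₁≢fromℕ m even y)
  goInner y _ σy≡z (inj z) = trans σy≡z (trans
    (cong inject₁ (trans (sym (lookup-del σ (inject₁ y) σy≡z)) (delσ≡π (inject₁ y))))
    (sym (pi-inject₁-inject₁ m even y)))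
  go : ∀ i → LastOrInject i → lookup σ i ≡ lookup π i
  go _ last = trans σn≡j (trans (cong inject₁ j≡m) (sym (pi-fromℕ-suc m even)))
  go _ (inj x) with lastOrInject x
  ... | last = trans (cong (lookup σ ∘ inject₁) (sym j≡m)) (trans σj≡n (sym (pi-inject₁-fromℕ m even)))
  ... | inj y = goInner y _ refl (lastOrInject (lookup σ (inject₁ (inject₁ y))))

-- Inverting by search

find-sound : ∀ {A : Set} {p : A → Bool} xs {x} → find p xs ≡ just x → p x ≡ true
find-sound {p = p} (y List.∷ ys) found with p y in py | found
... | true | refl = py
... | false | found′ = find-sound ys found′

invOn-cases : ∀ n g (τ : Perm n) →
  invOn n g τ ≡ τ ⊎ (inDomain n (invOn n g τ) ≡ true × g (invOn n g τ) ≡ τ)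
invOn-cases n g τ with find (λ σ → inDomain n σ ∧ (g σ =ᵛ τ)) (allVecs n n) in found
... | nothing = inj₁ refl
... | just σ with inDomain n σ | find-sound (allVecs n n) found
...   | true | gσ≡τ = inj₂ (refl , =ᵛ⇒≡ gσ≡τ)

OnlyPreimageOfItself : ∀ n → (Perm n → Perm n) → Perm n → Set
OnlyPreimageOfItself n g τ = ∀ σ → inDomain n σ ≡ true → g σ ≡ τ → σ ≡ τ

invOn-self : ∀ n g {τ} → OnlyPreimageOfItself n g τ → invOn n g τ ≡ τ
invOn-self n g {τ} only with invOn-cases n g τ
... | inj₁ default = default
... | inj₂ (dom , gσ≡τ) = only _ dom gσ≡τ

invOn-reflects : ∀ n g {σ τ} → g σ ≡ σ → invOn n g τ ≡ σ → τ ≡ σ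
invOn-reflects n g {σ} {τ} gσ≡σ inv≡σ with invOn-cases n g τ
... | inj₁ default = trans (sym default) inv≡σ
... | inj₂ (_ , gσ′≡τ) = trans (sym gσ′≡τ) (trans (cong g inv≡σ) gσ≡σ)

-- One step of the recursion

module _ (m : ℕ) (g : Perm (suc m) → Perm (suc m)) where

  private
    N : ℕ
    N = suc (suc m)

    n̂ : Fin N
    n̂ = fromℕ (suc m)

    g⁻¹ : Perm (suc m) → Perm (suc m)
    g⁻¹ = invOn (suc m) g

  αStep-iii : isOdd m ≡ true → αStep m g (pi N) ≡ f n̂ (g⁻¹ (pi (suc m)))
  αStep-iii odd = if-cong (cong₂ _∧_ odd (isYes-yes (pi N ≟ᵖ pi N) refl))

  module _ {σ : Perm N} (¬iii : (isOdd m ∧ (σ =ᵛ pi N)) ≡ false) where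

    αStep-i : lookup σ (lookup σ n̂) ≢ n̂ → αStep m g σ ≡ f (lookup σ n̂) (del σ)
    αStep-i ≢n̂ = trans (if-cong ¬iii) (if-cong (isYes-no (lookup σ (lookup σ n̂) Fin.≟ n̂) ≢n̂))

    αStep-ii : lookup σ (lookup σ n̂) ≡ n̂ → (isOdd (suc m) ∧ (g⁻¹ (del σ) =ᵛ pi (suc m))) ≡ false →
               αStep m g σ ≡ f n̂ (g⁻¹ (del σ))
    αStep-ii ≡n̂ ¬π = trans (if-cong ¬iii)
      (trans (if-cong (isYes-yes (lookup σ (lookup σ n̂) Fin.≟ n̂) ≡n̂)) (if-cong ¬π))

    αStep-ii-pi : lookup σ (lookup σ n̂) ≡ n̂ → isOdd (suc m) ≡ true → g⁻¹ (del σ) ≡ pi (suc m) →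
                  αStep m g σ ≡ pi N
    αStep-ii-pi ≡n̂ odd ρ≡π = trans (if-cong ¬iii)
      (trans (if-cong (isYes-yes (lookup σ (lookup σ n̂) Fin.≟ n̂) ≡n̂))
             (if-cong (cong₂ _∧_ odd (isYes-yes (g⁻¹ (del σ) ≟ᵖ pi (suc m)) ρ≡π))))

  αStep-pi : OnlyPreimageOfItself (suc m) g (pi (suc m)) → αStep m g (pi N) ≡ pi N
  αStep-pi only with parity m
  ... | inj₁ odd = begin
    αStep m g (pi N)          ≡⟨ αStep-iii odd ⟩
    f n̂ (g⁻¹ (pi (suc m)))    ≡⟨ cong (f n̂) (invOn-self (suc m) g only) ⟩
    f n̂ (pi (suc m))          ≡⟨ f-fromℕ-pi (suc m) (odd⇒suc-even m odd) ⟩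
    pi N                      ∎
  ... | inj₂ even = αStep-ii-pi (cong (_∧ (pi N =ᵛ pi N)) even) (pi-involutive N n̂) (even⇒suc-odd m even)
                                (trans (cong g⁻¹ (del-pi m even)) (invOn-self (suc m) g only))

  module _ (gπ≡π : g (pi (suc m)) ≡ pi (suc m)) {σ : Perm N} (σ≢π : σ ≢ pi N)
           (σ-der : isDerangement σ ≡ true) (ασ≡π : αStep m g σ ≡ pi N) where

    private
      ¬iii : (isOdd m ∧ (σ =ᵛ pi N)) ≡ false
      ¬iii = trans (cong (isOdd m ∧_) (isYes-no (σ ≟ᵖ pi N) σ≢π)) (∧-zeroʳ (isOdd m))

      ρ : Perm (suc m)
      ρ = g⁻¹ (del σ)

      noFix : ∀ i → lookup σ i ≢ i
      noFix = isDerangement⇒noFix σ σ-der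

      j : Fin (suc m)
      j = proj₁ (≢fromℕ⇒inject₁ (lookup σ n̂) (noFix n̂))

      σn̂≡j : lookup σ n̂ ≡ inject₁ j
      σn̂≡j = proj₂ (≢fromℕ⇒inject₁ (lookup σ n̂) (noFix n̂))

    σ-swaps-n̂ : lookup σ (lookup σ n̂) ≡ n̂
    σ-swaps-n̂ = decidable-stable (lookup σ (lookup σ n̂) Fin.≟ n̂) λ ≢n̂ →
      noFix n̂ (pi-fixed⇒fromℕ (suc m) (lookup σ n̂) (begin
        lookup (pi N) (lookup σ n̂)
          ≡⟨ cong (λ τ → lookup τ (lookup σ n̂)) (trans (sym ασ≡π) (αStep-i ¬iii ≢n̂)) ⟩
        lookup (f (lookup σ n̂) (del σ)) (lookup σ n̂)
          ≡⟨ lookup-f-fixed (lookup σ n̂) (del σ) ⟩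
        lookup σ n̂
          ∎))

    σj≡n̂ : lookup σ (inject₁ j) ≡ n̂
    σj≡n̂ = trans (cong (lookup σ) (sym σn̂≡j)) σ-swaps-n̂

    derangement-preimage≡pi : σ ≡ pi N
    derangement-preimage≡pi with parity m
    ... | inj₁ odd = ⊥-elim (pi-noFix (suc m) (odd⇒suc-even m odd) j (begin
      lookup (pi (suc m)) j   ≡⟨ cong (λ τ → lookup τ j) delσ≡π ⟨
      lookup (del σ) j        ≡⟨ lookup-del-skip σ j σj≡n̂ σn̂≡j ⟩
      j                       ∎))
      where
      fρ≡π : f n̂ ρ ≡ pi N
      fρ≡π = trans (sym (αStep-ii ¬iii σ-swaps-n̂ (cong (_∧ (ρ =ᵛ pi (suc m))) (odd⇒suc-even m odd)))) ασ≡π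
      delσ≡π : del σ ≡ pi (suc m)
      delσ≡π = invOn-reflects (suc m) g gπ≡π
        (f-fromℕ-injective (trans fρ≡π (sym (f-fromℕ-pi (suc m) (odd⇒suc-even m odd)))))
    ... | inj₂ even = byCases (ρ ≟ᵖ pi (suc m))
      where
      byCases : Dec (ρ ≡ pi (suc m)) → σ ≡ pi N
      byCases (yes ρ≡π) = del≡pi⇒≡pi m σ even σn̂≡j σj≡n̂ (invOn-reflects (suc m) g gπ≡π ρ≡π)
      byCases (no ρ≢π) =
        ⊥-elim (pi-noFix N even n̂ (trans (cong (λ τ → lookup τ n̂) (sym fρ≡π)) (lookup-f-fromℕ-fromℕ ρ)))
        where
        ¬ii-pi : (isOdd (suc m) ∧ (ρ =ᵛ pi (suc m))) ≡ false
        ¬ii-pi = trans (cong (isOdd (suc m) ∧_) (isYes-no (ρ ≟ᵖ pi (suc m)) ρ≢π)) (∧-zeroʳ _)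
        fρ≡π : f n̂ ρ ≡ pi N
        fρ≡π = trans (sym (αStep-ii ¬iii σ-swaps-n̂ ¬ii-pi)) ασ≡π

  αStep-onlyPreimage : g (pi (suc m)) ≡ pi (suc m) → OnlyPreimageOfItself N (αStep m g) (pi N)
  αStep-onlyPreimage gπ≡π σ dom ασ≡π = byCases (σ ≟ᵖ pi N)
    where
    byCases : Dec (σ ≡ pi N) → σ ≡ pi N
    byCases (yes σ≡π) = σ≡π
    byCases (no σ≢π) = derangement-preimage≡pi gπ≡π σ≢π (inDomain⇒isDerangement σ≢π dom) ασ≡π

α-pi : ∀ m → α (suc m) (pi (suc m)) ≡ pi (suc m) × OnlyPreimageOfItself (suc m) (α (suc m)) (pi (suc m))
α-pi zero = refl , λ { (zero ∷ []) _ _ → refl }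
α-pi (suc m) with α-pi m
... | απ≡π , only = αStep-pi m (α (suc m)) only , αStep-onlyPreimage m (α (suc m)) απ≡π

lemma1 : (n : ℕ) → 1 ≤ n → (α n (pi n) ≡ pi n) × (αInv n (pi n) ≡ pi n)
lemma1 (suc m) _ = proj₁ (α-pi m) , invOn-self (suc m) (α (suc m)) (proj₂ (α-pi m))
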